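{- Let $\Sigma$ be an aggregate signature, $\mathcal D$ a $\Sigma$-structure, $\Pi$ a set of defined predicates and $P$ a stratified $\Sigma(\Pi)$-aggregate program. Then the $triv$-well-founded model of $P$ is two-valued, i.e. of the form $(M,M)$, and $M$ is equal to the standard model of $P$ and to the unique $triv$-stable model of $P$.
   Context: An aggregate signature $\Sigma$ has sorts, sorted function, predicate and aggregate symbols $\mathsf R:\{s_1\times\dots\times s_n\}\times w$; set expressions $\{(x_1,\dots,x_n)\mid\varphi\}$, aggregate atoms $\mathsf R(s,t)$ and aggregate formulas (closed under $\neg,\wedge,\vee,\forall,\exists$) are defined simultaneously; a $\Sigma$-structure $\mathcal D$ interprets aggregate symbols by aggregate relations $\mathsf R^{\mathcal D}\subseteq\mathcal P(s_1^{\mathcal D}\times\dots\times s_n^{\mathcal D})\times w^{\mathcal D}$, a set expression by its set of satisfying tuples, and $\mathsf R(s,t)$ holds iff the pair of values is in $\mathsf R^{\mathcal D}$. Programs: $\Pi$ is a set of predicate symbols not in $\Sigma$; rules $A\leftarrow\varphi$ with $A$ a $\Pi$-atom and $\varphi$ a $\Sigma(\Pi)$-aggregate formula. Interpretations are subsets of $base_{\mathcal D}(\Pi)$; $T_{P,\mathcal D}(I)$ is the set of heads of ground instances $A\leftarrow\varphi$ of rules with $\mathcal D(I)\models\varphi$ ($\mathcal D(I)$ makes exactly the atoms of $I$ true). Stratified: there is $\lambda:\Pi\to\{1,2,\dots\}$ with maximum $m$ such that for each rule with head predicate $p$ and body $B$: $q\in\Pi$ occurring in $B$ outside aggregate atoms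 under an even number of negations has $\lambda(q)\le\lambda(p)$, and $q$ occurring under an odd number of negations or inside an aggregate atom has $\lambda(q)<\lambda(p)$. With $P_i$ the rules with head of level $i$ and $\Pi_i$ the level-$i$ predicates: $\mathcal D_0=\mathcal D$, $I_i=$ least fixpoint of the monotone $T_{P_i,\mathcal D_{i-1}}$ ($P_i$ with defined predicates $\Pi_i$ over $\Sigma\cup\Pi_1\cup\dots\cup\Pi_{i-1}$), $\mathcal D_i=\mathcal D(I_1\cup\dots\cup I_i)$; standard model $=I_1\cup\dots\cup I_m$. Three-valued semantics: $\mathbf{THREE}=\{(\mathbf f,\mathbf f),(\mathbf f,\mathbf t),(\mathbf t,\mathbf t)\}$ (false, unknown, true); truth order componentwise with meet $\wedge$, join $\vee$; $\neg(x,y)=(\neg y,\neg x)$. For an aggregate relation $R$, $triv(R)((S_1,S_2),d)$ is unknown if $S_1\ne S_2$ and is true if $S_1=S_2$ and $(S_1,d)\in R$, false if $S_1=S_2$ and $(S_1,d)\notin R$. A three-valued interpretation is $(I_1,I_2)$, $I_1\subseteq I_2$, giving atom $A$ value $(A\in I_1,A\in I_2)$. Formula values are computed inductively: $\Sigma$-atoms as in $\mathcal D$, defined atoms via $(I_1,I_2)$, $\mathbf{THREE}$ connectives, quantifiers as join/meet over domains, a set expression $\{\bar x\mid\psi\}$ evaluates to $(S_1,S_2)$ with $S_1$ (resp. $S_2$) the tuples where $\psi(\bar d)$ is true (resp. not false), and $\mathsf R(s,t)$ to $triv(\mathsf R^{\mathcal D})$ of the values. $\Phi_{P,triv}(I_1,I_2)$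 gives each ground atom $A$ the join of the values of bodies of ground rules with head $A$ (false if none). The $triv$-well-founded model and $triv$-stable models are the well-founded fixpoint and exact stable fixpoints of $\Phi_{P,triv}$: with components $A^1,A^2$ of $A=\Phi_{P,triv}$, $A^\downarrow(b)=\mathrm{glb}\{x\subseteq b\mid A^1(x,b)\subseteq x\}$, $A^\uparrow(a)=\mathrm{glb}\{x\supseteq a\mid A^2(a,x)\subseteq x\}$, $\mathcal S(a,b)=(A^\downarrow(b),A^\uparrow(a))$; the well-founded fixpoint is the least fixpoint in the precision order ($(a,b)\le_p(a',b')$ iff $a\subseteq a'$, $b'\subseteq b$) of $\mathcal S$ on pairs with $(a,b)\le_p A(a,b)$ and $a\subseteq A^\downarrow(b)$; exact stable fixpoints are the $I$ with $\mathcal S(I,I)=(I,I)$. -}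

module Defs where

open import Data.Bool using (Bool; true; false; _∧_; _∨_; not; if_then_else_)
open import Data.Nat using (ℕ; zero; suc; _≤_; _<_)
open import Data.List using (List; []; _∷_; _++_)
open import Data.List.Membership.Propositional using (_∈_)
open import Data.List.Relation.Unary.Any using (here; there)
open import Data.Product using (Σ; _×_; _,_; proj₁; proj₂; ∃)
open import Data.Sum using (_⊎_)
open import Data.Empty using (⊥)
open import Relation.Nullary using (Dec; does)
open import Relation.Binary.PropositionalEquality using (_≡_; refl)

-- Excluded middle (for propositions in Set) is taken as an explicit
-- hypothesis of the theorem; it is used to turn propositions into Bool
-- (classical two-valued truth).

LEM₀ : Set₁
LEM₀ = (A : Set) → Dec A

data Tuple {S : Set} (D : S → Set) : List S → Set where
  []  : Tuple D []
  _∷_ : ∀ {s ss} → D s → Tuple D ss → Tuple D (s ∷ ss)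

lookupT : ∀ {S : Set} {D : S → Set} {s : S} {ss : List S} → Tuple D ss → s ∈ ss → D s
lookupT (d ∷ ds) (here refl) = d
lookupT (d ∷ ds) (there p)   = lookupT ds p

_++ᵗ_ : ∀ {S : Set} {D : S → Set} {ss ts : List S} → Tuple D ss → Tuple D ts → Tuple D (ss ++ ts)
[] ++ᵗ ys       = ys
(x ∷ xs) ++ᵗ ys = x ∷ (xs ++ᵗ ys)

record Signature : Set₁ where
  field
    Sort     : Set
    Fun      : Set
    funArgs  : Fun → List Sort
    funRes   : Fun → Sort
    Pred     : Set
    predArgs : Pred → List Sort
    Agg      : Set
    -- R : {s₁ × … × sₙ} × w
    aggSet   : Agg → List Sort
    aggRes   : Agg → Sort

-- A set Π of (sorted) defined predicate symbols, disjoint from Σ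
-- (disjointness is automatic: they live in a separate type).
record DefinedPreds (Sig : Signature) : Set₁ where
  open Signature Sig
  field
    DPred : Set
    dArgs : DPred → List Sort

-- Subsets of a set X are represented by characteristic
-- functions X → Bool; an aggregate relation R ⊆ 𝒫(s₁×…×sₙ) × w is a
-- Bool-valued function on (subset, element) which respects extensional
-- equality of subsets (so it is really a relation on subsets).
record Structure (Sig : Signature) : Set₁ where
  open Signature Sig
  field
    Dom    : Sort → Set
    funI   : (f : Fun) → Tuple Dom (funArgs f) → Dom (funRes f)
    predI  : (p : Pred) → Tuple Dom (predArgs p) → Bool
    aggI   : (R : Agg) → (Tuple Dom (aggSet R) → Bool) → Dom (aggRes R) → Bool
    aggExt : (R : Agg) (S S' : Tuple Dom (aggSet R) → Bool) →
             (∀ xs → S xs ≡ S' xs) → ∀ d → aggI R S d ≡ aggI R S' d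

module Syntax (Sig : Signature) (Π : DefinedPreds Sig) where
  open Signature Sig
  open DefinedPreds Π

  Ctx : Set
  Ctx = List Sort

  mutual
    data Term (Γ : Ctx) : Sort → Set where
      var : ∀ {s} → s ∈ Γ → Term Γ s
      app : (f : Fun) → Terms Γ (funArgs f) → Term Γ (funRes f)

    data Terms (Γ : Ctx) : List Sort → Set where
      []  : Terms Γ []
      _∷_ : ∀ {s ss} → Term Γ s → Terms Γ ss → Terms Γ (s ∷ ss)

  mutual
    -- set expression {(x₁,…,xₙ) ∣ φ} binding variables of sorts ss
    data SetExpr (Γ : Ctx) (ss : List Sort) : Set where
      setOf : Formula (ss ++ Γ) → SetExpr Γ ss

    data Formula (Γ : Ctx) : Set where
      patom   : (p : Pred) → Terms Γ (predArgs p) → Formula Γ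
      datom   : (q : DPred) → Terms Γ (dArgs q) → Formula Γ
      aggAtom : (R : Agg) → SetExpr Γ (aggSet R) → Term Γ (aggRes R) → Formula Γ
      neg     : Formula Γ → Formula Γ
      and     : Formula Γ → Formula Γ → Formula Γ
      or      : Formula Γ → Formula Γ → Formula Γ
      all     : (s : Sort) → Formula (s ∷ Γ) → Formula Γ
      ex      : (s : Sort) → Formula (s ∷ Γ) → Formula Γ

  record Rule : Set where
    field
      ctx      : Ctx
      headPred : DPred
      headArgs : Terms ctx (dArgs headPred)
      body     : Formula ctx

  -- a program is a (possibly infinite) set of rules
  record Program : Set₁ where
    field
      Index : Set
      rule  : Index → Rule

  mutual
    OccAnyS : ∀ {Γ ss} → DPred → SetExpr Γ ss → Set
    OccAnyS q (setOf φ) = OccAny q φ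

    OccAny : ∀ {Γ} → DPred → Formula Γ → Set
    OccAny q (patom p ts)      = ⊥
    OccAny q (datom q' ts)     = q' ≡ q
    OccAny q (aggAtom R S t)   = OccAnyS q S
    OccAny q (neg φ)           = OccAny q φ
    OccAny q (and φ ψ)         = OccAny q φ ⊎ OccAny q ψ
    OccAny q (or φ ψ)          = OccAny q φ ⊎ OccAny q ψ
    OccAny q (all s φ)         = OccAny q φ
    OccAny q (ex s φ)          = OccAny q φ

  InAgg : ∀ {Γ} → DPred → Formula Γ → Set
  InAgg q (patom p ts)    = ⊥
  InAgg q (datom q' ts)   = ⊥
  InAgg q (aggAtom R S t) = OccAnyS q S
  InAgg q (neg φ)         = InAgg q φ
  InAgg q (and φ ψ)       = InAgg q φ ⊎ InAgg q ψ
  InAgg q (or φ ψ)        = InAgg q φ ⊎ InAgg q ψ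
  InAgg q (all s φ)       = InAgg q φ
  InAgg q (ex s φ)        = InAgg q φ

  -- Occ q b φ : q occurs in φ outside aggregate atoms, and b flipped once
  -- per enclosing negation ends up true.  So  Occ q true φ  = occurs under
  -- an even number of negations, Occ q false φ = under an odd number.
  Occ : ∀ {Γ} → DPred → Bool → Formula Γ → Set
  Occ q b (patom p ts)    = ⊥
  Occ q b (datom q' ts)   = (b ≡ true) × (q' ≡ q)
  Occ q b (aggAtom R S t) = ⊥
  Occ q b (neg φ)         = Occ q (not b) φ
  Occ q b (and φ ψ)       = Occ q b φ ⊎ Occ q b ψ
  Occ q b (or φ ψ)        = Occ q b φ ⊎ Occ q b ψ
  Occ q b (all s φ)       = Occ q b φ
  Occ q b (ex s φ)        = Occ q b φ

  record Stratification (P : Program) : Set where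
    open Program P
    open Rule
    field
      level     : DPred → ℕ
      m         : ℕ
      level-pos : ∀ q → 1 ≤ level q
      level-max : ∀ q → level q ≤ m
      even-ok   : ∀ (i : Index) (q : DPred) → Occ q true (body (rule i)) →
                  level q ≤ level (headPred (rule i))
      odd-ok    : ∀ (i : Index) (q : DPred) → Occ q false (body (rule i)) →
                  level q < level (headPred (rule i))
      agg-ok    : ∀ (i : Index) (q : DPred) → InAgg q (body (rule i)) →
                  level q < level (headPred (rule i))

module Semantics (lem : LEM₀) (Sig : Signature) (Π : DefinedPreds Sig)
                 (D : Structure Sig) (P : Syntax.Program Sig Π) where
  open Signature Sig
  open DefinedPreds Π
  open Structure D
  open Syntax Sig Π
  open Program P
  open Rule

  dec : Set → Bool
  dec A = does (lem A)

  Env : Ctx → Set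
  Env Γ = Tuple Dom Γ

  Atom : Set
  Atom = Σ DPred (λ q → Tuple Dom (dArgs q))

  Interp : Set
  Interp = Atom → Bool

  _⊆_ : Interp → Interp → Set
  X ⊆ Y = ∀ A → X A ≡ true → Y A ≡ true

  _≈_ : Interp → Interp → Set
  X ≈ Y = ∀ A → X A ≡ Y A

  _∪_ : Interp → Interp → Interp
  (X ∪ Y) A = X A ∨ Y A

  ∅ : Interp
  ∅ A = false

  mutual
    evalTerm : ∀ {Γ s} → Term Γ s → Env Γ → Dom s
    evalTerm (var x) η    = lookupT η x
    evalTerm (app f ts) η = funI f (evalTerms ts η)

    evalTerms : ∀ {Γ ss} → Terms Γ ss → Env Γ → Tuple Dom ss
    evalTerms [] η       = []
    evalTerms (t ∷ ts) η = evalTerm t η ∷ evalTerms ts η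

  mutual
    evalSet2 : ∀ {Γ ss} → Interp → SetExpr Γ ss → Env Γ → Tuple Dom ss → Bool
    evalSet2 I (setOf φ) η xs = eval2 I φ (xs ++ᵗ η)

    eval2 : ∀ {Γ} → Interp → Formula Γ → Env Γ → Bool
    eval2 I (patom p ts) η    = predI p (evalTerms ts η)
    eval2 I (datom q ts) η    = I (q , evalTerms ts η)
    eval2 I (aggAtom R S t) η = aggI R (evalSet2 I S η) (evalTerm t η)
    eval2 I (neg φ) η         = not (eval2 I φ η)
    eval2 I (and φ ψ) η       = eval2 I φ η ∧ eval2 I ψ η
    eval2 I (or φ ψ) η        = eval2 I φ η ∨ eval2 I ψ η
    eval2 I (all s φ) η       = dec (∀ d → eval2 I φ (d ∷ η) ≡ true)
    eval2 I (ex s φ) η        = dec (Σ (Dom s) λ d → eval2 I φ (d ∷ η) ≡ true)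

  headAtom : (r : Index) → Env (ctx (rule r)) → Atom
  headAtom r η = (headPred (rule r) , evalTerms (headArgs (rule r)) η)

  module Standard (st : Stratification P) where
    open Stratification st

    -- T_{P_i, 𝒟_{i-1}}(J), where Lower = I₁ ∪ … ∪ I_{i-1}
    T : ℕ → Interp → Interp → Interp
    T i Lower J A = dec (Σ Index λ r → level (headPred (rule r)) ≡ i ×
                          Σ (Env (ctx (rule r))) λ η → headAtom r η ≡ A ×
                          eval2 (Lower ∪ J) (body (rule r)) η ≡ true)

    AtLevel : ℕ → Interp → Set
    AtLevel i X = ∀ A → X A ≡ true → level (proj₁ A) ≡ i

    IsLeastFixpoint : ℕ → Interp → Interp → Set
    IsLeastFixpoint i Lower X =
      AtLevel i X × (T i Lower X ≈ X) ×
      (∀ Y → AtLevel i Y → T i Lower Y ≈ Y → X ⊆ Y)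

    UnionUpTo : (ℕ → Interp) → ℕ → Interp
    UnionUpTo I zero    = ∅
    UnionUpTo I (suc j) = UnionUpTo I j ∪ I (suc j)

    IsStandardModel : Interp → Set
    IsStandardModel M =
      Σ (ℕ → Interp) λ I →
        (∀ j → suc j ≤ m → IsLeastFixpoint (suc j) (UnionUpTo I j) (I (suc j))) ×
        (M ≈ UnionUpTo I m)

  -- THREE ⊆ Bool × Bool : (f,f) false, (f,t) unknown, (t,t) true
  Three : Set
  Three = Bool × Bool

  _⊓_ : Three → Three → Three
  (x , y) ⊓ (x' , y') = (x ∧ x' , y ∧ y')

  _⊔_ : Three → Three → Three
  (x , y) ⊔ (x' , y') = (x ∨ x' , y ∨ y')

  ¬₃ : Three → Three
  ¬₃ (x , y) = (not y , not x)

  triv : (R : Agg) → (Tuple Dom (aggSet R) → Bool) → (Tuple Dom (aggSet R) → Bool) →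
         Dom (aggRes R) → Three
  triv R S₁ S₂ d =
    if dec (∀ xs → S₁ xs ≡ S₂ xs)
    then (aggI R S₁ d , aggI R S₁ d)
    else (false , true)

  mutual
    evalSet3 : ∀ {Γ ss} → Interp → Interp → SetExpr Γ ss → Env Γ →
               (Tuple Dom ss → Bool) × (Tuple Dom ss → Bool)
    evalSet3 I₁ I₂ (setOf φ) η =
      (λ xs → proj₁ (eval3 I₁ I₂ φ (xs ++ᵗ η))) ,
      (λ xs → proj₂ (eval3 I₁ I₂ φ (xs ++ᵗ η)))

    eval3 : ∀ {Γ} → Interp → Interp → Formula Γ → Env Γ → Three
    eval3 I₁ I₂ (patom p ts) η    = (predI p (evalTerms ts η) , predI p (evalTerms ts η))
    eval3 I₁ I₂ (datom q ts) η    = (I₁ (q , evalTerms ts η) , I₂ (q , evalTerms ts η))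
    eval3 I₁ I₂ (aggAtom R S t) η =
      triv R (proj₁ (evalSet3 I₁ I₂ S η)) (proj₂ (evalSet3 I₁ I₂ S η)) (evalTerm t η)
    eval3 I₁ I₂ (neg φ) η         = ¬₃ (eval3 I₁ I₂ φ η)
    eval3 I₁ I₂ (and φ ψ) η       = eval3 I₁ I₂ φ η ⊓ eval3 I₁ I₂ ψ η
    eval3 I₁ I₂ (or φ ψ) η        = eval3 I₁ I₂ φ η ⊔ eval3 I₁ I₂ ψ η
    eval3 I₁ I₂ (all s φ) η       =
      ( dec (∀ d → proj₁ (eval3 I₁ I₂ φ (d ∷ η)) ≡ true)
      , dec (∀ d → proj₂ (eval3 I₁ I₂ φ (d ∷ η)) ≡ true) )
    eval3 I₁ I₂ (ex s φ) η        =
      ( dec (Σ (Dom s) λ d → proj₁ (eval3 I₁ I₂ φ (d ∷ η)) ≡ true)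
      , dec (Σ (Dom s) λ d → proj₂ (eval3 I₁ I₂ φ (d ∷ η)) ≡ true) )

  Φ₁ : Interp → Interp → Interp
  Φ₁ I₁ I₂ A = dec (Σ Index λ r → Σ (Env (ctx (rule r))) λ η → headAtom r η ≡ A ×
                     proj₁ (eval3 I₁ I₂ (body (rule r)) η) ≡ true)

  Φ₂ : Interp → Interp → Interp
  Φ₂ I₁ I₂ A = dec (Σ Index λ r → Σ (Env (ctx (rule r))) λ η → headAtom r η ≡ A ×
                     proj₂ (eval3 I₁ I₂ (body (rule r)) η) ≡ true)

  IsGlb : Interp → (Interp → Set) → Set
  IsGlb g F = (∀ x → F x → g ⊆ x) × (∀ z → (∀ x → F x → z ⊆ x) → z ⊆ g)

  -- A^↓(b) = glb{x ⊆ b ∣ A¹(x,b) ⊆ x},  A^↑(a) = glb{x ⊇ a ∣ A²(a,x) ⊆ x}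
  DownFamily : Interp → Interp → Set
  DownFamily b x = x ⊆ b × Φ₁ x b ⊆ x

  UpFamily : Interp → Interp → Set
  UpFamily a x = a ⊆ x × Φ₂ a x ⊆ x

  IsStableOp : Interp → Interp → Interp → Interp → Set
  IsStableOp a b c d = IsGlb c (DownFamily b) × IsGlb d (UpFamily a)

  IsFixS : Interp → Interp → Set
  IsFixS a b = IsStableOp a b a b

  -- domain of 𝒮 for the well-founded fixpoint:
  -- (a,b) ≤ₚ A(a,b)  and  a ⊆ A^↓(b)
  WFDomain : Interp → Interp → Set
  WFDomain a b = (a ⊆ Φ₁ a b × Φ₂ a b ⊆ b) ×
                 (∀ g → IsGlb g (DownFamily b) → a ⊆ g)

  _≤ₚ_ : Interp × Interp → Interp × Interp → Set
  (a , b) ≤ₚ (c , d) = a ⊆ c × d ⊆ b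

  IsWellFoundedModel : Interp → Interp → Set
  IsWellFoundedModel a b =
    WFDomain a b × IsFixS a b ×
    (∀ c d → WFDomain c d → IsFixS c d → (a , b) ≤ₚ (c , d))

  IsStableModel : Interp → Set
  IsStableModel I = IsFixS I I

module Submission where

-- The standard model M is a supported model of P, and on each stratum i it is the least
-- interpretation closed under the rules of stratum i among those agreeing with M below i.
-- A rule body mentions its own stratum only positively and outside aggregate atoms, so its
-- three-valued value is monotone in the truth order along interpretations that agree below
-- the head's stratum and grow on it.  By induction on strata, every fixpoint (c , d) of the
-- stable operator with Φ₂ (c , d) ⊆ d therefore equals (M , M) on stratum i: c contains M
-- there because c is closed under the stratum-i rules, and cutting c (resp. d) down to M on
-- stratum i keeps it in the family of which c (resp. d) is the glb.  This covers the
-- well-founded candidates and all exact stable fixpoints, and (M , M) is itself such a fixpoint.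

open import Defs
open import Data.Bool using (Bool; true; false; _∧_; _∨_; not; if_then_else_)
open import Data.Bool.Properties using (∧-conicalˡ; ∧-conicalʳ; ∨-identityʳ; ¬-not)
open import Data.Empty using (⊥-elim)
open import Data.Nat using (ℕ; zero; suc; _≤_; _<_; s≤s; _≤′_; ≤′-refl; ≤′-step; s≤s⁻¹)
open import Data.Nat.Induction using (<-rec)
open import Data.Nat.Properties using (m≤n⇒m<n∨m≡n; <⇒≢; <⇒≤; ≤-reflexive; ≤⇒≤′; ≤′⇒≤)
open import Data.Product using (Σ; ∃; _×_; _,_; proj₁; proj₂)
open import Data.Sum using (inj₁; inj₂)
open import Function using (_∘_; id)
open import Relation.Nullary using (yes; no; does; ¬_)
open import Relation.Nullary.Decidable using (dec-true; dec-false)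
open import Relation.Binary.PropositionalEquality
  using (_≡_; _≢_; _≗_; refl; sym; trans; cong; cong₂; subst; module ≡-Reasoning)

infix 4 _⇛_

_⇛_ : Bool → Bool → Set
a ⇛ b = a ≡ true → b ≡ true

⇛-antisym : ∀ {a b} → a ⇛ b → b ⇛ a → a ≡ b
⇛-antisym {true}  {b}     a⇛b _   = sym (a⇛b refl)
⇛-antisym {false} {true}  _   b⇛a = b⇛a refl
⇛-antisym {false} {false} _   _   = refl

∧-mono-⇛ : ∀ {a b a′ b′} → a ⇛ a′ → b ⇛ b′ → a ∧ b ⇛ a′ ∧ b′
∧-mono-⇛ {true} {true} a⇛a′ b⇛b′ _ rewrite a⇛a′ refl | b⇛b′ refl = refl

∨-mono-⇛ : ∀ {a b a′ b′} → a ⇛ a′ → b ⇛ b′ → a ∨ b ⇛ a′ ∨ b′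
∨-mono-⇛ {true}                a⇛a′ _    _ rewrite a⇛a′ refl = refl
∨-mono-⇛ {false} {a′ = true}  _    _    _ = refl
∨-mono-⇛ {false} {a′ = false} _    b⇛b′   = b⇛b′

∧-intro : ∀ {a b} → a ≡ true → b ≡ true → a ∧ b ≡ true
∧-intro refl refl = refl

not-anti-⇛ : ∀ {a b} → a ⇛ b → not b ⇛ not a
not-anti-⇛ {true}  {false} a⇛b _ = a⇛b refl
not-anti-⇛ {false}         _   _ = refl

module Classical (lem : LEM₀) where

  decide : ∀ {A : Set} → A → does (lem A) ≡ true
  decide = dec-true (lem _)

  decided : ∀ {A : Set} → does (lem A) ≡ true → A
  decided {A} with lem A
  ... | yes a = λ _ → a
  ... | no _  = λ ()

  dec-mono : ∀ {A B : Set} → (A → B) → does (lem A) ⇛ does (lem B)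
  dec-mono f = decide ∘ f ∘ decided

module ThreeValued (lem : LEM₀) (Sig : Signature) (Π : DefinedPreds Sig) (D : Structure Sig)
                   (P : Syntax.Program Sig Π) where
  open Classical lem
  open Signature Sig
  open Structure D
  open Syntax Sig Π
  open Program P
  open Rule
  open Semantics lem Sig Π D P

  ⊆-refl : ∀ {X} → X ⊆ X
  ⊆-refl _ = id

  ⊆-trans : ∀ {X Y Z} → X ⊆ Y → Y ⊆ Z → X ⊆ Z
  ⊆-trans X⊆Y Y⊆Z A = Y⊆Z A ∘ X⊆Y A

  infix 4 _≤₃_ _⊑₃_

  _≤₃_ : Three → Three → Set
  (x₁ , x₂) ≤₃ (y₁ , y₂) = (x₁ ⇛ y₁) × (x₂ ⇛ y₂)

  _⊑₃_ : Three → Three → Set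
  (x₁ , x₂) ⊑₃ (y₁ , y₂) = (x₁ ⇛ y₁) × (y₂ ⇛ x₂)

  ≤₃-reflexive : ∀ {x y} → x ≡ y → x ≤₃ y
  ≤₃-reflexive refl = id , id

  ≤₃-antisym : ∀ {x y} → x ≤₃ y → y ≤₃ x → x ≡ y
  ≤₃-antisym (le₁ , le₂) (ge₁ , ge₂) = cong₂ _,_ (⇛-antisym le₁ ge₁) (⇛-antisym le₂ ge₂)

  ⊑₃-reflexive : ∀ {x y} → x ≡ y → x ⊑₃ y
  ⊑₃-reflexive refl = id , id

  ¬₃-antitone : ∀ {x y} → x ≤₃ y → ¬₃ y ≤₃ ¬₃ x
  ¬₃-antitone (le₁ , le₂) = not-anti-⇛ le₂ , not-anti-⇛ le₁

  ⊓-mono : ∀ {x y x′ y′} → x ≤₃ x′ → y ≤₃ y′ → x ⊓ y ≤₃ x′ ⊓ y′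
  ⊓-mono (le₁ , le₂) (le₁′ , le₂′) = ∧-mono-⇛ le₁ le₁′ , ∧-mono-⇛ le₂ le₂′

  ⊔-mono : ∀ {x y x′ y′} → x ≤₃ x′ → y ≤₃ y′ → x ⊔ y ≤₃ x′ ⊔ y′
  ⊔-mono (le₁ , le₂) (le₁′ , le₂′) = ∨-mono-⇛ le₁ le₁′ , ∨-mono-⇛ le₂ le₂′

  ¬₃-mono-⊑ : ∀ {x y} → x ⊑₃ y → ¬₃ x ⊑₃ ¬₃ y
  ¬₃-mono-⊑ (le₁ , le₂) = not-anti-⇛ le₂ , not-anti-⇛ le₁

  ⊓-mono-⊑ : ∀ {x y x′ y′} → x ⊑₃ x′ → y ⊑₃ y′ → x ⊓ y ⊑₃ x′ ⊓ y′
  ⊓-mono-⊑ (le₁ , le₂) (le₁′ , le₂′) = ∧-mono-⇛ le₁ le₁′ , ∧-mono-⇛ le₂ le₂′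

  ⊔-mono-⊑ : ∀ {x y x′ y′} → x ⊑₃ x′ → y ⊑₃ y′ → x ⊔ y ⊑₃ x′ ⊔ y′
  ⊔-mono-⊑ (le₁ , le₂) (le₁′ , le₂′) = ∨-mono-⇛ le₁ le₁′ , ∨-mono-⇛ le₂ le₂′

  -- eval3 of ∀ and ∃ unfolds to ⋀ and ⋁ of the values of the body.
  ⋀ ⋁ : {A : Set} → (A → Three) → Three
  ⋀ f = dec (∀ d → proj₁ (f d) ≡ true) , dec (∀ d → proj₂ (f d) ≡ true)
  ⋁ f = dec (∃ λ d → proj₁ (f d) ≡ true) , dec (∃ λ d → proj₂ (f d) ≡ true)

  all-mono : {A : Set} {f g : A → Bool} → (∀ d → f d ⇛ g d) →
             dec (∀ d → f d ≡ true) ⇛ dec (∀ d → g d ≡ true)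
  all-mono f⇛g = dec-mono λ all-f d → f⇛g d (all-f d)

  any-mono : {A : Set} {f g : A → Bool} → (∀ d → f d ⇛ g d) →
             dec (∃ λ d → f d ≡ true) ⇛ dec (∃ λ d → g d ≡ true)
  any-mono f⇛g = dec-mono λ (d , fd) → d , f⇛g d fd

  ⋀-mono : {A : Set} {f g : A → Three} → (∀ d → f d ≤₃ g d) → ⋀ f ≤₃ ⋀ g
  ⋀-mono le = all-mono (proj₁ ∘ le) , all-mono (proj₂ ∘ le)

  ⋁-mono : {A : Set} {f g : A → Three} → (∀ d → f d ≤₃ g d) → ⋁ f ≤₃ ⋁ g
  ⋁-mono le = any-mono (proj₁ ∘ le) , any-mono (proj₂ ∘ le)

  ⋀-mono-⊑ : {A : Set} {f g : A → Three} → (∀ d → f d ⊑₃ g d) → ⋀ f ⊑₃ ⋀ g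
  ⋀-mono-⊑ le = all-mono (proj₁ ∘ le) , all-mono (proj₂ ∘ le)

  ⋁-mono-⊑ : {A : Set} {f g : A → Three} → (∀ d → f d ⊑₃ g d) → ⋁ f ⊑₃ ⋁ g
  ⋁-mono-⊑ le = any-mono (proj₁ ∘ le) , any-mono (proj₂ ∘ le)

  ⋀-cong : {A : Set} {f g : A → Three} → f ≗ g → ⋀ f ≡ ⋀ g
  ⋀-cong f≗g = ≤₃-antisym (⋀-mono (≤₃-reflexive ∘ f≗g)) (⋀-mono (≤₃-reflexive ∘ sym ∘ f≗g))

  ⋁-cong : {A : Set} {f g : A → Three} → f ≗ g → ⋁ f ≡ ⋁ g
  ⋁-cong f≗g = ≤₃-antisym (⋁-mono (≤₃-reflexive ∘ f≗g)) (⋁-mono (≤₃-reflexive ∘ sym ∘ f≗g))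

  module _ (R : Agg) (d : Dom (aggRes R)) where

    triv-exact : ∀ {S₁ S₂} → S₁ ≗ S₂ → triv R S₁ S₂ d ≡ (aggI R S₁ d , aggI R S₁ d)
    triv-exact S₁≗S₂ = cong (λ b → if b then _ else (false , true)) (decide S₁≗S₂)

    triv-inexact : ∀ {S₁ S₂} → ¬ S₁ ≗ S₂ → triv R S₁ S₂ d ≡ (false , true)
    triv-inexact S₁≉S₂ = cong (λ b → if b then _ else (false , true)) (dec-false (lem _) S₁≉S₂)

    triv-cong : ∀ {S₁ S₂ S₁′ S₂′} → S₁ ≗ S₁′ → S₂ ≗ S₂′ → triv R S₁ S₂ d ≡ triv R S₁′ S₂′ d
    triv-cong {S₁} {S₂} {S₁′} {S₂′} S₁≗S₁′ S₂≗S₂′ with lem (S₁ ≗ S₂)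
    ... | yes S₁≗S₂ = begin
      triv R S₁ S₂ d                ≡⟨ triv-exact S₁≗S₂ ⟩
      (aggI R S₁ d , aggI R S₁ d)   ≡⟨ cong (λ b → b , b) (aggExt R S₁ S₁′ S₁≗S₁′ d) ⟩
      (aggI R S₁′ d , aggI R S₁′ d) ≡⟨ sym (triv-exact S₁′≗S₂′) ⟩
      triv R S₁′ S₂′ d              ∎
      where
      open ≡-Reasoning
      S₁′≗S₂′ : S₁′ ≗ S₂′
      S₁′≗S₂′ xs = trans (sym (S₁≗S₁′ xs)) (trans (S₁≗S₂ xs) (S₂≗S₂′ xs))
    ... | no S₁≉S₂ = trans (triv-inexact S₁≉S₂) (sym (triv-inexact S₁′≉S₂′))
      where
      S₁′≉S₂′ : ¬ S₁′ ≗ S₂′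
      S₁′≉S₂′ S₁′≗S₂′ = S₁≉S₂ λ xs → trans (S₁≗S₁′ xs) (trans (S₁′≗S₂′ xs) (sym (S₂≗S₂′ xs)))

    triv-mono-⊑ : ∀ {S₁ S₂ S₁′ S₂′} → (∀ xs → S₁ xs ⇛ S₁′ xs) → (∀ xs → S₁′ xs ⇛ S₂′ xs) →
                  (∀ xs → S₂′ xs ⇛ S₂ xs) → triv R S₁ S₂ d ⊑₃ triv R S₁′ S₂′ d
    triv-mono-⊑ {S₁} {S₂} {S₁′} {S₂′} S₁⊆S₁′ S₁′⊆S₂′ S₂′⊆S₂ with lem (S₁ ≗ S₂)
    ... | yes S₁≗S₂ = ⊑₃-reflexive (triv-cong S₁≗S₁′ S₂≗S₂′)
      where
      S₁≗S₁′ : S₁ ≗ S₁′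
      S₁≗S₁′ xs = ⇛-antisym (S₁⊆S₁′ xs) (trans (S₁≗S₂ xs) ∘ S₂′⊆S₂ xs ∘ S₁′⊆S₂′ xs)
      S₂≗S₂′ : S₂ ≗ S₂′
      S₂≗S₂′ xs = ⇛-antisym (S₁′⊆S₂′ xs ∘ S₁⊆S₁′ xs ∘ trans (S₁≗S₂ xs)) (S₂′⊆S₂ xs)
    ... | no S₁≉S₂ = subst (_⊑₃ triv R S₁′ S₂′ d) (sym (triv-inexact S₁≉S₂)) ((λ ()) , (λ _ → refl))

  eval3-exact : ∀ {Γ} (φ : Formula Γ) I η → eval3 I I φ η ≡ (eval2 I φ η , eval2 I φ η)
  eval3-exact (patom p ts)            I η = refl
  eval3-exact (datom q ts)            I η = refl
  eval3-exact (aggAtom R (setOf φ) t) I η =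
    trans (triv-cong R d (cong proj₁ ∘ exact-φ) (cong proj₂ ∘ exact-φ)) (triv-exact R d λ _ → refl)
    where
    d : Dom (aggRes R)
    d = evalTerm t η
    exact-φ : ∀ xs → eval3 I I φ (xs ++ᵗ η) ≡ (eval2 I φ (xs ++ᵗ η) , eval2 I φ (xs ++ᵗ η))
    exact-φ xs = eval3-exact φ I (xs ++ᵗ η)
  eval3-exact (neg φ)   I η = cong ¬₃ (eval3-exact φ I η)
  eval3-exact (and φ ψ) I η = cong₂ _⊓_ (eval3-exact φ I η) (eval3-exact ψ I η)
  eval3-exact (or φ ψ)  I η = cong₂ _⊔_ (eval3-exact φ I η) (eval3-exact ψ I η)
  eval3-exact (all s φ) I η = ⋀-cong λ d → eval3-exact φ I (d ∷ η)
  eval3-exact (ex s φ)  I η = ⋁-cong λ d → eval3-exact φ I (d ∷ η)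

  exact₁ : ∀ {Γ} (φ : Formula Γ) I η → proj₁ (eval3 I I φ η) ≡ eval2 I φ η
  exact₁ φ I η = cong proj₁ (eval3-exact φ I η)

  exact₂ : ∀ {Γ} (φ : Formula Γ) I η → proj₂ (eval3 I I φ η) ≡ eval2 I φ η
  exact₂ φ I η = cong proj₂ (eval3-exact φ I η)

  AgreeOn : ∀ {Γ} → Formula Γ → Interp → Interp → Set
  AgreeOn φ I J = ∀ q → OccAny q φ → ∀ xs → I (q , xs) ≡ J (q , xs)

  eval3-cong : ∀ {Γ} (φ : Formula Γ) {I₁ I₂ J₁ J₂} → AgreeOn φ I₁ J₁ → AgreeOn φ I₂ J₂ →
               ∀ η → eval3 I₁ I₂ φ η ≡ eval3 J₁ J₂ φ η
  eval3-cong (patom p ts)            e₁ e₂ η = refl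
  eval3-cong (datom q ts)            e₁ e₂ η = cong₂ _,_ (e₁ q refl _) (e₂ q refl _)
  eval3-cong (aggAtom R (setOf φ) t) {I₁} {I₂} {J₁} {J₂} e₁ e₂ η =
    triv-cong R (evalTerm t η) (cong proj₁ ∘ cong-φ) (cong proj₂ ∘ cong-φ)
    where
    cong-φ : ∀ xs → eval3 I₁ I₂ φ (xs ++ᵗ η) ≡ eval3 J₁ J₂ φ (xs ++ᵗ η)
    cong-φ xs = eval3-cong φ e₁ e₂ (xs ++ᵗ η)
  eval3-cong (neg φ)   e₁ e₂ η = cong ¬₃ (eval3-cong φ e₁ e₂ η)
  eval3-cong (and φ ψ) e₁ e₂ η =
    cong₂ _⊓_ (eval3-cong φ (λ q → e₁ q ∘ inj₁) (λ q → e₂ q ∘ inj₁) η)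
              (eval3-cong ψ (λ q → e₁ q ∘ inj₂) (λ q → e₂ q ∘ inj₂) η)
  eval3-cong (or φ ψ)  e₁ e₂ η =
    cong₂ _⊔_ (eval3-cong φ (λ q → e₁ q ∘ inj₁) (λ q → e₂ q ∘ inj₁) η)
              (eval3-cong ψ (λ q → e₁ q ∘ inj₂) (λ q → e₂ q ∘ inj₂) η)
  eval3-cong (all s φ) e₁ e₂ η = ⋀-cong λ d → eval3-cong φ e₁ e₂ (d ∷ η)
  eval3-cong (ex s φ)  e₁ e₂ η = ⋁-cong λ d → eval3-cong φ e₁ e₂ (d ∷ η)

  eval2-cong : ∀ {Γ} (φ : Formula Γ) {X Y} → X ≈ Y → ∀ η → eval2 X φ η ≡ eval2 Y φ η
  eval2-cong φ {X} {Y} X≈Y η = begin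
    eval2 X φ η              ≡⟨ exact₁ φ X η ⟨
    proj₁ (eval3 X X φ η)    ≡⟨ cong proj₁ (eval3-cong φ agree agree η) ⟩
    proj₁ (eval3 Y Y φ η)    ≡⟨ exact₁ φ Y η ⟩
    eval2 Y φ η              ∎
    where
    open ≡-Reasoning
    agree : AgreeOn φ X Y
    agree q _ xs = X≈Y (q , xs)

  mutual
    eval3-mono-⊑ : ∀ {Γ} (φ : Formula Γ) {I₁ I₂ J₁ J₂} → (I₁ , I₂) ≤ₚ (J₁ , J₂) → J₁ ⊆ J₂ →
                   ∀ η → eval3 I₁ I₂ φ η ⊑₃ eval3 J₁ J₂ φ η
    eval3-mono-⊑ (patom p ts)            _               _     η = id , id
    eval3-mono-⊑ (datom q ts)            (I₁⊆J₁ , J₂⊆I₂) _     η = I₁⊆J₁ _ , J₂⊆I₂ _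
    eval3-mono-⊑ (aggAtom R (setOf φ) t) {I₁} {I₂} {J₁} {J₂} I≤J J₁⊆J₂ η =
      triv-mono-⊑ R (evalTerm t η) (proj₁ ∘ mono-φ) (λ xs → eval3-consistent φ J₁⊆J₂ (xs ++ᵗ η))
                  (proj₂ ∘ mono-φ)
      where
      mono-φ : ∀ xs → eval3 I₁ I₂ φ (xs ++ᵗ η) ⊑₃ eval3 J₁ J₂ φ (xs ++ᵗ η)
      mono-φ xs = eval3-mono-⊑ φ I≤J J₁⊆J₂ (xs ++ᵗ η)
    eval3-mono-⊑ (neg φ)   I≤J J₁⊆J₂ η = ¬₃-mono-⊑ (eval3-mono-⊑ φ I≤J J₁⊆J₂ η)
    eval3-mono-⊑ (and φ ψ) I≤J J₁⊆J₂ η =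
      ⊓-mono-⊑ (eval3-mono-⊑ φ I≤J J₁⊆J₂ η) (eval3-mono-⊑ ψ I≤J J₁⊆J₂ η)
    eval3-mono-⊑ (or φ ψ)  I≤J J₁⊆J₂ η =
      ⊔-mono-⊑ (eval3-mono-⊑ φ I≤J J₁⊆J₂ η) (eval3-mono-⊑ ψ I≤J J₁⊆J₂ η)
    eval3-mono-⊑ (all s φ) I≤J J₁⊆J₂ η = ⋀-mono-⊑ λ d → eval3-mono-⊑ φ I≤J J₁⊆J₂ (d ∷ η)
    eval3-mono-⊑ (ex s φ)  I≤J J₁⊆J₂ η = ⋁-mono-⊑ λ d → eval3-mono-⊑ φ I≤J J₁⊆J₂ (d ∷ η)

    eval3-approximates : ∀ {Γ} (φ : Formula Γ) {I₁ I₂ J} → I₁ ⊆ J → J ⊆ I₂ →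
                         ∀ η → eval3 I₁ I₂ φ η ⊑₃ (eval2 J φ η , eval2 J φ η)
    eval3-approximates φ {I₁} {I₂} {J} I₁⊆J J⊆I₂ η =
      subst (eval3 I₁ I₂ φ η ⊑₃_) (eval3-exact φ J η) (eval3-mono-⊑ φ (I₁⊆J , J⊆I₂) ⊆-refl η)

    eval3-consistent : ∀ {Γ} (φ : Formula Γ) {I₁ I₂} → I₁ ⊆ I₂ →
                       ∀ η → proj₁ (eval3 I₁ I₂ φ η) ⇛ proj₂ (eval3 I₁ I₂ φ η)
    eval3-consistent φ I₁⊆I₂ η =
      let true⇒ , ⇒true = eval3-approximates φ ⊆-refl I₁⊆I₂ η in ⇒true ∘ true⇒

  RuleValuation : Set
  RuleValuation = (r : Index) → Env (ctx (rule r)) → Bool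

  -- Φ₁ I₁ I₂, Φ₂ I₁ I₂ and TP I all unfold to Heads v for the appropriate v.
  Heads : RuleValuation → Interp
  Heads v A = dec (Σ Index λ r → Σ (Env (ctx (rule r))) λ η → headAtom r η ≡ A × v r η ≡ true)

  heads-intro : ∀ {v : RuleValuation} r η → v r η ≡ true → Heads v (headAtom r η) ≡ true
  heads-intro r η vrη = decide (r , η , refl , vrη)

  heads-⊆ : ∀ {v : RuleValuation} {X} → (∀ r η → v r η ≡ true → X (headAtom r η) ≡ true) →
            Heads v ⊆ X
  heads-⊆ closed A A∈heads with decided A∈heads
  ... | r , η , refl , vrη = closed r η vrη

  heads-mono : ∀ {v w : RuleValuation} → (∀ r η → v r η ⇛ w r η) → Heads v ⊆ Heads w
  heads-mono v⇛w = heads-⊆ λ r η → heads-intro r η ∘ v⇛w r η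

  TP : Interp → Interp
  TP I = Heads λ r η → eval2 I (body (rule r)) η

  Φ-mono-⊑ : ∀ {I₁ I₂ J₁ J₂} → (I₁ , I₂) ≤ₚ (J₁ , J₂) → J₁ ⊆ J₂ →
             (Φ₁ I₁ I₂ , Φ₂ I₁ I₂) ≤ₚ (Φ₁ J₁ J₂ , Φ₂ J₁ J₂)
  Φ-mono-⊑ I≤J J₁⊆J₂ =
    heads-mono (λ r η → proj₁ (eval3-mono-⊑ (body (rule r)) I≤J J₁⊆J₂ η)) ,
    heads-mono (λ r η → proj₂ (eval3-mono-⊑ (body (rule r)) I≤J J₁⊆J₂ η))

  Φ₁-exact : ∀ I → Φ₁ I I ⊆ TP I × TP I ⊆ Φ₁ I I
  Φ₁-exact I = heads-mono (λ r η → subst (_≡ true) (exact₁ (body (rule r)) I η)) ,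
               heads-mono (λ r η → subst (_≡ true) (sym (exact₁ (body (rule r)) I η)))

  Φ₂-exact : ∀ I → Φ₂ I I ⊆ TP I
  Φ₂-exact I = heads-mono λ r η → subst (_≡ true) (exact₂ (body (rule r)) I η)

  downGlb-prefixpoint : ∀ {c d} → IsGlb c (DownFamily d) → Φ₁ c d ⊆ c
  downGlb-prefixpoint (c-lower , c-greatest) =
    c-greatest _ λ x (x⊆d , Φx⊆x) →
      ⊆-trans (proj₁ (Φ-mono-⊑ (c-lower x (x⊆d , Φx⊆x) , ⊆-refl) x⊆d)) Φx⊆x

  stable-⊆ : ∀ {c d} → IsFixS c d → c ⊆ d
  stable-⊆ (_ , (_ , d-greatest)) = d-greatest _ λ _ → proj₁

  stable-downFamily : ∀ {c d} → IsFixS c d → DownFamily d c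
  stable-downFamily fix = stable-⊆ fix , downGlb-prefixpoint (proj₁ fix)

module Stratified (lem : LEM₀) (Sig : Signature) (Π : DefinedPreds Sig) (D : Structure Sig)
                  (P : Syntax.Program Sig Π) (st : Syntax.Stratification Sig Π P) where
  open Classical lem
  open Syntax Sig Π
  open Program P
  open Rule
  open Semantics lem Sig Π D P
  open Standard st
  open Stratification st
  open ThreeValued lem Sig Π D P

  lvl : Atom → ℕ
  lvl A = level (proj₁ A)

  level-suc : ∀ q → ∃ λ k → level q ≡ suc k
  level-suc q with level q | level-pos q
  ... | suc k | _ = k , refl

  stratified-induction : {Q : Atom → Set} → (∀ i → (∀ B → lvl B < i → Q B) → ∀ B → lvl B ≡ i → Q B) →
                         ∀ B → Q B
  stratified-induction {Q} step B =
    <-rec (λ i → ∀ B → lvl B ≡ i → Q B) (λ i below → step i λ B′ lt → below lt B′ refl) (lvl B) B refl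

  offLevel : ∀ {i X} → AtLevel i X → ∀ B → lvl B ≢ i → X B ≡ false
  offLevel X-at-i B B-off = ¬-not (B-off ∘ X-at-i B)

  AgreeBelow : ℕ → Interp → Interp → Set
  AgreeBelow i X Y = ∀ B → lvl B < i → X B ≡ Y B

  infix 4 _≤[_]_

  record _≤[_]_ (X : Interp) (i : ℕ) (Y : Interp) : Set where
    field
      agree   : AgreeBelow i X Y
      include : ∀ B → lvl B ≡ i → X B ⇛ Y B
  open _≤[_]_

  ≤[]-refl : ∀ {X i} → X ≤[ i ] X
  ≤[]-refl = record { agree = λ _ _ → refl ; include = λ _ _ → id }

  agreeUpTo⇒≤[] : ∀ {X Y i} → (∀ B → lvl B ≤ i → X B ≡ Y B) → X ≤[ i ] Y
  agreeUpTo⇒≤[] X≈Y = record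
    { agree   = λ B lt → X≈Y B (<⇒≤ lt)
    ; include = λ B B-at → subst (_≡ true) (X≈Y B (≤-reflexive B-at))
    }

  -- The stratification conditions for a subformula occurring under polarity p in a rule of stratum h.
  Bounded : ∀ {Γ} → ℕ → Bool → Formula Γ → Set
  Bounded h p φ = (∀ q → Occ q p φ → level q ≤ h) ×
                  (∀ q → Occ q (not p) φ → level q < h) ×
                  (∀ q → InAgg q φ → level q < h)

  -- Used for or φ ψ as well: Occ and InAgg treat and and or alike.
  bounded-split : ∀ {Γ h p} (φ ψ : Formula Γ) → Bounded h p (and φ ψ) → Bounded h p φ × Bounded h p ψ
  bounded-split φ ψ (same , opposite , agg) =
    ((λ q → same q ∘ inj₁) , (λ q → opposite q ∘ inj₁) , (λ q → agg q ∘ inj₁)) ,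
    ((λ q → same q ∘ inj₂) , (λ q → opposite q ∘ inj₂) , (λ q → agg q ∘ inj₂))

  Mono : Bool → Three → Three → Set
  Mono true  x y = x ≤₃ y
  Mono false x y = y ≤₃ x

  mono-≡ : ∀ p {x y} → x ≡ y → Mono p x y
  mono-≡ true  = ≤₃-reflexive
  mono-≡ false = ≤₃-reflexive ∘ sym

  mono-¬₃ : ∀ p {x y} → Mono (not p) x y → Mono p (¬₃ x) (¬₃ y)
  mono-¬₃ true  = ¬₃-antitone
  mono-¬₃ false = ¬₃-antitone

  mono-⊓ : ∀ p {x y x′ y′} → Mono p x x′ → Mono p y y′ → Mono p (x ⊓ y) (x′ ⊓ y′)
  mono-⊓ true  = ⊓-mono
  mono-⊓ false = ⊓-mono

  mono-⊔ : ∀ p {x y x′ y′} → Mono p x x′ → Mono p y y′ → Mono p (x ⊔ y) (x′ ⊔ y′)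
  mono-⊔ true  = ⊔-mono
  mono-⊔ false = ⊔-mono

  mono-⋀ : ∀ p {A : Set} {f g : A → Three} → (∀ d → Mono p (f d) (g d)) → Mono p (⋀ f) (⋀ g)
  mono-⋀ true  = ⋀-mono
  mono-⋀ false = ⋀-mono

  mono-⋁ : ∀ p {A : Set} {f g : A → Three} → (∀ d → Mono p (f d) (g d)) → Mono p (⋁ f) (⋁ g)
  mono-⋁ true  = ⋁-mono
  mono-⋁ false = ⋁-mono

  eval3-mono-stratified : ∀ {Γ} h p (φ : Formula Γ) → Bounded h p φ →
                          ∀ {I₁ I₂ J₁ J₂} → I₁ ≤[ h ] J₁ → I₂ ≤[ h ] J₂ →
                          ∀ η → Mono p (eval3 I₁ I₂ φ η) (eval3 J₁ J₂ φ η)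
  eval3-mono-stratified h p (patom _ _) _ _ _ _ = mono-≡ p refl
  eval3-mono-stratified h true (datom q ts) (same , _ , _) I₁≤J₁ I₂≤J₂ η
    with m≤n⇒m<n∨m≡n (same q (refl , refl))
  ... | inj₁ below = ≤₃-reflexive (cong₂ _,_ (agree I₁≤J₁ _ below) (agree I₂≤J₂ _ below))
  ... | inj₂ at    = include I₁≤J₁ _ at , include I₂≤J₂ _ at
  eval3-mono-stratified h false (datom q ts) (_ , opposite , _) I₁≤J₁ I₂≤J₂ η =
    mono-≡ false (cong₂ _,_ (agree I₁≤J₁ _ below) (agree I₂≤J₂ _ below))
    where
    below : level q < h
    below = opposite q (refl , refl)
  eval3-mono-stratified h p (aggAtom R S t) (_ , _ , agg) I₁≤J₁ I₂≤J₂ η =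
    mono-≡ p (eval3-cong (aggAtom R S t) (λ q o xs → agree I₁≤J₁ (q , xs) (agg q o))
                                         (λ q o xs → agree I₂≤J₂ (q , xs) (agg q o)) η)
  eval3-mono-stratified h p (neg φ) b I₁≤J₁ I₂≤J₂ η =
    mono-¬₃ p (eval3-mono-stratified h (not p) φ b I₁≤J₁ I₂≤J₂ η)
  eval3-mono-stratified h p (and φ ψ) b I₁≤J₁ I₂≤J₂ η =
    let bφ , bψ = bounded-split φ ψ b
    in mono-⊓ p (eval3-mono-stratified h p φ bφ I₁≤J₁ I₂≤J₂ η)
                (eval3-mono-stratified h p ψ bψ I₁≤J₁ I₂≤J₂ η)
  eval3-mono-stratified h p (or φ ψ) b I₁≤J₁ I₂≤J₂ η =
    let bφ , bψ = bounded-split φ ψ b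
    in mono-⊔ p (eval3-mono-stratified h p φ bφ I₁≤J₁ I₂≤J₂ η)
                (eval3-mono-stratified h p ψ bψ I₁≤J₁ I₂≤J₂ η)
  eval3-mono-stratified h p (all s φ) b I₁≤J₁ I₂≤J₂ η =
    mono-⋀ p λ d → eval3-mono-stratified h p φ b I₁≤J₁ I₂≤J₂ (d ∷ η)
  eval3-mono-stratified h p (ex s φ) b I₁≤J₁ I₂≤J₂ η =
    mono-⋁ p λ d → eval3-mono-stratified h p φ b I₁≤J₁ I₂≤J₂ (d ∷ η)

  body-mono : ∀ r {h} → level (headPred (rule r)) ≡ h →
              ∀ {I₁ I₂ J₁ J₂} → I₁ ≤[ h ] J₁ → I₂ ≤[ h ] J₂ →
              ∀ η → eval3 I₁ I₂ (body (rule r)) η ≤₃ eval3 J₁ J₂ (body (rule r)) η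
  body-mono r refl = eval3-mono-stratified _ true (body (rule r)) (even-ok r , odd-ok r , agg-ok r)

  body-mono₂ : ∀ r {h} → level (headPred (rule r)) ≡ h → ∀ {X Y} → X ≤[ h ] Y →
               ∀ η → eval2 X (body (rule r)) η ⇛ eval2 Y (body (rule r)) η
  body-mono₂ r r-at {X} {Y} X≤Y η =
    subst (_≡ true) (exact₁ (body (rule r)) Y η) ∘ proj₁ (body-mono r r-at X≤Y X≤Y η) ∘
    subst (_≡ true) (sym (exact₁ (body (rule r)) X η))

  ClosedAt : ℕ → Interp → Set
  ClosedAt i Y = ∀ r → level (headPred (rule r)) ≡ i → ∀ η →
                 eval2 Y (body (rule r)) η ≡ true → Y (headAtom r η) ≡ true

  module StandardModel where

    T-intro : ∀ {i L J} r → level (headPred (rule r)) ≡ i → ∀ η →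
              eval2 (L ∪ J) (body (rule r)) η ≡ true → T i L J (headAtom r η) ≡ true
    T-intro r r-at η holds = decide (r , r-at , η , refl , holds)

    T-⊆ : ∀ {i L J X} → (∀ r → level (headPred (rule r)) ≡ i → ∀ η →
                          eval2 (L ∪ J) (body (rule r)) η ≡ true → X (headAtom r η) ≡ true) →
          T i L J ⊆ X
    T-⊆ closed A A∈T with decided A∈T
    ... | r , r-at , η , refl , holds = closed r r-at η holds

    T-atLevel : ∀ {i L J} → AtLevel i (T i L J)
    T-atLevel A A∈T with decided A∈T
    ... | r , r-at , η , refl , _ = r-at

    T-mono : ∀ {i L J J′} → AtLevel i J → AtLevel i J′ → J ⊆ J′ → T i L J ⊆ T i L J′
    T-mono {i} {L} {J} {J′} J-at J′-at J⊆J′ =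
      T-⊆ {L = L} {J} λ r r-at η → T-intro {L = L} {J′} r r-at η ∘ body-mono₂ r r-at L∪J≤L∪J′ η
      where
      L∪J≤L∪J′ : (L ∪ J) ≤[ i ] (L ∪ J′)
      L∪J≤L∪J′ = record
        { agree   = λ B lt → cong (L B ∨_) (trans (offLevel J-at B (<⇒≢ lt))
                                                   (sym (offLevel J′-at B (<⇒≢ lt))))
        ; include = λ B _ → ∨-mono-⇛ id (J⊆J′ B)
        }

    T-⊆-lower : ∀ {i L L′} J → L ≈ L′ → T i L J ⊆ T i L′ J
    T-⊆-lower {L = L} {L′} J L≈L′ =
      T-⊆ {L = L} {J} λ r r-at η →
        T-intro {L = L′} {J} r r-at η ∘ subst (_≡ true) (eval2-cong (body (rule r)) L∪J≈L′∪J η)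
      where
      L∪J≈L′∪J : (L ∪ J) ≈ (L′ ∪ J)
      L∪J≈L′∪J B = cong (_∨ J B) (L≈L′ B)

    T-cong : ∀ {i L L′} J → L ≈ L′ → T i L J ≈ T i L′ J
    T-cong J L≈L′ A = ⇛-antisym (T-⊆-lower J L≈L′ A) (T-⊆-lower J (sym ∘ L≈L′) A)

    lfp : ℕ → Interp → Interp
    lfp i L A = dec (∀ Y → AtLevel i Y → T i L Y ⊆ Y → Y A ≡ true)

    lfp-least : ∀ {i L Y} → AtLevel i Y → T i L Y ⊆ Y → lfp i L ⊆ Y
    lfp-least Y-at TY⊆Y A A∈lfp = decided A∈lfp _ Y-at TY⊆Y

    lfp-atLevel : ∀ {i L} → AtLevel i (lfp i L)
    lfp-atLevel {i} {L} A =
      decided ∘ lfp-least {i} {L} {Stratum} (λ _ → decided) (λ A → decide ∘ T-atLevel {i} {L} A) A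
      where
      Stratum : Interp
      Stratum A = dec (lvl A ≡ i)

    lfp-prefixpoint : ∀ {i L} → T i L (lfp i L) ⊆ lfp i L
    lfp-prefixpoint {i} {L} A A∈T =
      decide λ Y Y-at TY⊆Y → TY⊆Y A (T-mono lfp-atLevel Y-at (lfp-least {i} {L} Y-at TY⊆Y) A A∈T)

    lfp-postfixpoint : ∀ {i L} → lfp i L ⊆ T i L (lfp i L)
    lfp-postfixpoint {i} {L} =
      lfp-least {i} {L} (T-atLevel {i} {L})
                (T-mono (T-atLevel {i} {L}) lfp-atLevel (lfp-prefixpoint {i} {L}))

    lfp-isLeastFixpoint : ∀ {i L} → IsLeastFixpoint i L (lfp i L)
    lfp-isLeastFixpoint =
      lfp-atLevel ,
      (λ A → ⇛-antisym (lfp-prefixpoint A) (lfp-postfixpoint A)) ,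
      (λ Y Y-at TY≈Y → lfp-least Y-at (λ A → subst (_≡ true) (TY≈Y A)))

    U : ℕ → Interp
    U zero    = ∅
    U (suc j) = U j ∪ lfp (suc j) (U j)

    strata : ℕ → Interp
    strata zero    = ∅
    strata (suc j) = lfp (suc j) (U j)

    U≈UnionUpTo : ∀ j → U j ≈ UnionUpTo strata j
    U≈UnionUpTo zero    A = refl
    U≈UnionUpTo (suc j) A = cong (_∨ strata (suc j) A) (U≈UnionUpTo j A)

    M : Interp
    M = U m

    M-standard : IsStandardModel M
    M-standard = strata , (λ j _ → strata-isLeastFixpoint j) , U≈UnionUpTo m
      where
      strata-isLeastFixpoint : ∀ j → IsLeastFixpoint (suc j) (UnionUpTo strata j) (strata (suc j))
      strata-isLeastFixpoint j =
        let at , fix , least = lfp-isLeastFixpoint {suc j} {U j}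
            lower = U≈UnionUpTo j
        in at ,
           (λ A → trans (sym (T-cong _ lower A)) (fix A)) ,
           (λ Y Y-at TY≈Y → least Y Y-at λ A → trans (T-cong Y lower A) (TY≈Y A))

    U-above : ∀ j B → j < lvl B → U j B ≡ false
    U-above zero    B _    = refl
    U-above (suc j) B j<B =
      cong₂ _∨_ (U-above j B (<⇒≤ j<B)) (offLevel lfp-atLevel B (<⇒≢ j<B ∘ sym))

    U-settled : ∀ {j} B → lvl B ≤′ j → U j B ≡ U (lvl B) B
    U-settled B ≤′-refl = refl
    U-settled {suc j} B (≤′-step B≤j) =
      begin
        U j B ∨ lfp (suc j) (U j) B ≡⟨ cong (U j B ∨_) (offLevel lfp-atLevel B (<⇒≢ (s≤s (≤′⇒≤ B≤j)))) ⟩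
        U j B ∨ false               ≡⟨ ∨-identityʳ _ ⟩
        U j B                       ≡⟨ U-settled B B≤j ⟩
        U (lvl B) B                 ∎
      where open ≡-Reasoning

    U-agrees-M : ∀ j B → lvl B ≤ j → U j B ≡ M B
    U-agrees-M j B B≤j =
      trans (U-settled B (≤⇒≤′ B≤j)) (sym (U-settled B (≤⇒≤′ (level-max (proj₁ B)))))

    U≤M : ∀ k → U (suc k) ≤[ suc k ] M
    U≤M k = agreeUpTo⇒≤[] (U-agrees-M (suc k))

    M≤U : ∀ k → M ≤[ suc k ] U (suc k)
    M≤U k = agreeUpTo⇒≤[] λ B B≤k → sym (U-agrees-M (suc k) B B≤k)

    M-on-stratum : ∀ k B → lvl B ≡ suc k → M B ≡ lfp (suc k) (U k) B
    M-on-stratum k B B-at = begin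
      M B
        ≡⟨ U-agrees-M (suc k) B (≤-reflexive B-at) ⟨
      U k B ∨ lfp (suc k) (U k) B
        ≡⟨ cong (_∨ lfp (suc k) (U k) B) (U-above k B (≤-reflexive (sym B-at))) ⟩
      lfp (suc k) (U k) B         ∎
      where open ≡-Reasoning

    M-model : TP M ⊆ M
    M-model = heads-⊆ λ r η holds →
      let k , r-at = level-suc (headPred (rule r))
      in subst (_≡ true) (sym (M-on-stratum k _ r-at))
               (lfp-prefixpoint _ (T-intro {L = U k} {lfp (suc k) (U k)} r r-at η
                                             (body-mono₂ r r-at (M≤U k) η holds)))

    M-supported : M ⊆ TP M
    M-supported A A∈M =
      let k , A-at = level-suc (proj₁ A)
      in T-⊆ {L = U k} {J = lfp (suc k) (U k)}
             (λ r r-at η → heads-intro r η ∘ body-mono₂ r r-at (U≤M k) η) A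
             (lfp-postfixpoint A (subst (_≡ true) (M-on-stratum k A A-at) A∈M))

    M-least : ∀ i Y → ClosedAt i Y → AgreeBelow i Y M → ∀ B → lvl B ≡ i → M B ⇛ Y B
    M-least i Y Y-closed Y≈M B B-at =
      ∧-conicalˡ _ _ ∘ lfp-least Y′-at TY′⊆Y′ B ∘ subst (_≡ true) (M-on-stratum k B B-at′)
      where
      k : ℕ
      k = proj₁ (level-suc (proj₁ B))
      B-at′ : lvl B ≡ suc k
      B-at′ = proj₂ (level-suc (proj₁ B))
      i≡ : i ≡ suc k
      i≡ = trans (sym B-at) B-at′
      Y′ : Interp
      Y′ A = Y A ∧ dec (lvl A ≡ suc k)
      Y′-at : AtLevel (suc k) Y′
      Y′-at A = decided ∘ ∧-conicalʳ _ _
      U∪Y′≤Y : (U k ∪ Y′) ≤[ suc k ] Y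
      U∪Y′≤Y = record
        { agree   = λ B lt → trans (cong₂ _∨_ (U-agrees-M k B (s≤s⁻¹ lt)) (offLevel Y′-at B (<⇒≢ lt)))
                                   (trans (∨-identityʳ _) (sym (Y≈M B (subst (lvl B <_) (sym i≡) lt))))
        ; include = λ B B-at → ∧-conicalˡ _ _ ∘
                      subst (_≡ true) (cong (_∨ Y′ B) (U-above k B (≤-reflexive (sym B-at))))
        }
      TY′⊆Y′ : T (suc k) (U k) Y′ ⊆ Y′
      TY′⊆Y′ = T-⊆ {L = U k} {J = Y′} λ r r-at η holds →
        ∧-intro (Y-closed r (trans r-at (sym i≡)) η (body-mono₂ r r-at U∪Y′≤Y η holds)) (decide r-at)

  infixl 25 _∩[_]_

  _∩[_]_ : Interp → ℕ → Interp → Interp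
  (X ∩[ i ] Y) B = if dec (lvl B ≡ i) then X B ∧ Y B else X B

  module Cut (X : Interp) (i : ℕ) (Y : Interp) where

    cut-off : ∀ B → lvl B ≢ i → (X ∩[ i ] Y) B ≡ X B
    cut-off B B-off = cong (λ b → if b then _ else _) (dec-false (lem _) B-off)

    cut-at : ∀ B → lvl B ≡ i → (X ∩[ i ] Y) B ⇛ Y B
    cut-at B B-at with lem (lvl B ≡ i)
    ... | yes _     = ∧-conicalʳ _ _
    ... | no  B-off = ⊥-elim (B-off B-at)

    cut-⊆ : X ∩[ i ] Y ⊆ X
    cut-⊆ B with lem (lvl B ≡ i)
    ... | yes _ = ∧-conicalˡ _ _
    ... | no  _ = id

    cut-intro : ∀ {B} → X B ≡ true → (lvl B ≡ i → Y B ≡ true) → (X ∩[ i ] Y) B ≡ true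
    cut-intro {B} X∋B Y∋B with lem (lvl B ≡ i)
    ... | yes B-at = ∧-intro X∋B (Y∋B B-at)
    ... | no  _    = X∋B

    cut-≤[] : AgreeBelow i X Y → (X ∩[ i ] Y) ≤[ i ] Y
    cut-≤[] X≈Y = record
      { agree   = λ B lt → trans (cut-off B (<⇒≢ lt)) (X≈Y B lt)
      ; include = cut-at
      }

  module StableModels {M : Interp} (M-model : TP M ⊆ M) (M-supported : M ⊆ TP M)
                      (M-least : ∀ i Y → ClosedAt i Y → AgreeBelow i Y M →
                                 ∀ B → lvl B ≡ i → M B ⇛ Y B) where

    M-closed : ∀ r η → eval2 M (body (rule r)) η ≡ true → M (headAtom r η) ≡ true
    M-closed r η = M-model (headAtom r η) ∘ heads-intro r η

    downFamily-⊇M : ∀ {d x} i → DownFamily d x → AgreeBelow i x M → AgreeBelow i d M →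
                    ∀ B → lvl B ≡ i → M B ⇛ x B
    downFamily-⊇M {d} {x} i (x⊆d , Φx⊆x) x≈M d≈M = M-least i x x-closed x≈M
      where
      x≤d : x ≤[ i ] d
      x≤d = record { agree = λ B lt → trans (x≈M B lt) (sym (d≈M B lt)) ; include = λ B _ → x⊆d B }
      x-closed : ClosedAt i x
      x-closed r r-at η =
        Φx⊆x _ ∘ heads-intro r η ∘ proj₁ (body-mono r r-at ≤[]-refl x≤d η) ∘
        subst (_≡ true) (sym (exact₁ (body (rule r)) x η))

    module AtStratum {c d : Interp} (fix : IsFixS c d) (Φ₂⊆d : Φ₂ c d ⊆ d)
             (i : ℕ) (c≈M : AgreeBelow i c M) (d≈M : AgreeBelow i d M) where

      c⊆d : c ⊆ d
      c⊆d = stable-⊆ fix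

      M⊆c : ∀ B → lvl B ≡ i → M B ⇛ c B
      M⊆c = downFamily-⊇M i (stable-downFamily fix) c≈M d≈M

      -- Cutting c down to M on stratum i stays in DownFamily d, of which c is the glb.
      c⊆M : ∀ B → lvl B ≡ i → c B ⇛ M B
      c⊆M B B-at = cut-at B B-at ∘ proj₁ (proj₁ fix) x x∈down B
        where
        x : Interp
        x = c ∩[ i ] M
        open Cut c i M
        x⊆d : x ⊆ d
        x⊆d = ⊆-trans cut-⊆ c⊆d
        x∈down : DownFamily d x
        x∈down = x⊆d , heads-⊆ λ r η holds →
          cut-intro (downGlb-prefixpoint (proj₁ fix) _ (heads-intro r η
                       (proj₁ (eval3-mono-⊑ (body (rule r)) (cut-⊆ , ⊆-refl) c⊆d η) holds)))
                    (λ r-at → M-closed r η (body-mono₂ r r-at (cut-≤[] c≈M) η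
                                 (proj₁ (eval3-approximates (body (rule r)) ⊆-refl x⊆d η) holds)))

      -- Cutting d down to M on stratum i stays in UpFamily c, of which d is the glb.
      d⊆M : ∀ B → lvl B ≡ i → d B ⇛ M B
      d⊆M B B-at = cut-at B B-at ∘ proj₁ (proj₂ fix) x x∈up B
        where
        x : Interp
        x = d ∩[ i ] M
        open Cut d i M
        c⊆x : c ⊆ x
        c⊆x A A∈c = cut-intro (c⊆d A A∈c) λ A-at → c⊆M A A-at A∈c
        c≤M : c ≤[ i ] M
        c≤M = record { agree = c≈M ; include = c⊆M }
        x∈up : UpFamily c x
        x∈up = c⊆x , heads-⊆ λ r η holds →
          cut-intro (Φ₂⊆d _ (heads-intro r η
                       (proj₂ (eval3-mono-⊑ (body (rule r)) (⊆-refl , cut-⊆) c⊆x η) holds)))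
                    (λ r-at → M-closed r η (subst (_≡ true) (exact₂ (body (rule r)) M η)
                                 (proj₂ (body-mono r r-at c≤M (cut-≤[] d≈M) η) holds)))

    fixpoint-agrees : ∀ {c d} → IsFixS c d → Φ₂ c d ⊆ d → ∀ B → c B ≡ M B × d B ≡ M B
    fixpoint-agrees {c} {d} fix Φ₂⊆d = stratified-induction step
      where
      step : ∀ i → (∀ B → lvl B < i → c B ≡ M B × d B ≡ M B) →
             ∀ B → lvl B ≡ i → c B ≡ M B × d B ≡ M B
      step i below B B-at =
        ⇛-antisym (c⊆M B B-at) (M⊆c B B-at) , ⇛-antisym (d⊆M B B-at) (c⊆d B ∘ M⊆c B B-at)
        where open AtStratum fix Φ₂⊆d i (λ B lt → proj₁ (below B lt)) (λ B lt → proj₂ (below B lt))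

    Φ₁M⊆M : Φ₁ M M ⊆ M
    Φ₁M⊆M = ⊆-trans (proj₁ (Φ₁-exact M)) M-model

    Φ₂M⊆M : Φ₂ M M ⊆ M
    Φ₂M⊆M = ⊆-trans (Φ₂-exact M) M-model

    M⊆Φ₁M : M ⊆ Φ₁ M M
    M⊆Φ₁M = ⊆-trans M-supported (proj₂ (Φ₁-exact M))

    M-lowerBound-down : ∀ x → DownFamily M x → M ⊆ x
    M-lowerBound-down x x∈down = stratified-induction λ i below →
      downFamily-⊇M i x∈down (λ B lt → ⇛-antisym (proj₁ x∈down B) (below B lt)) (λ _ _ → refl)

    M-stable : IsStableModel M
    M-stable =
      (M-lowerBound-down , λ z z-lower → z-lower M (⊆-refl , Φ₁M⊆M)) ,
      ((λ _ → proj₁) , λ z z-lower → z-lower M (⊆-refl , Φ₂M⊆M))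

    M-wellFounded : IsWellFoundedModel M M
    M-wellFounded =
      ((M⊆Φ₁M , Φ₂M⊆M) , λ g g-glb → proj₂ g-glb M M-lowerBound-down) ,
      M-stable ,
      λ c d ((_ , Φ₂⊆d) , _) fix →
        (λ A → subst (_≡ true) (sym (proj₁ (fixpoint-agrees fix Φ₂⊆d A)))) ,
        (λ A → subst (_≡ true) (proj₂ (fixpoint-agrees fix Φ₂⊆d A)))

    M-unique : ∀ N → IsStableModel N → N ≈ M
    M-unique N fix = proj₁ ∘ fixpoint-agrees fix Φ₂⊆N
      where
      Φ₂⊆N : Φ₂ N N ⊆ N
      Φ₂⊆N = ⊆-trans (Φ₂-exact N) (⊆-trans (proj₂ (Φ₁-exact N)) (downGlb-prefixpoint (proj₁ fix)))

corollary3 : (lem : LEM₀) (Sig : Signature) (Π : DefinedPreds Sig) (D : Structure Sig)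
             (P : Syntax.Program Sig Π) (st : Syntax.Stratification Sig Π P) →
             let open Semantics lem Sig Π D P in
             let open Standard st in
             Σ Interp (λ M →
               IsStandardModel M ×
               IsWellFoundedModel M M ×
               IsStableModel M ×
               (∀ N → IsStableModel N → N ≈ M))
corollary3 lem Sig Π D P st = M , M-standard , M-wellFounded , M-stable , M-unique
  where
  open Stratified lem Sig Π D P st
  open StandardModel
  open StableModels M-model M-supported M-least
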